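{- Let $S\subseteq\Sigma^c$ with $|S|=n$ and let $k\ge4$. Then at most $3^c\cdot n^{k-2}$ tuples $(x_1,\dots,x_k)\in S^k$ are zero-sets, i.e. satisfy $\Delta_{i\in[k]}x_i=\emptyset$.
   Context: Each key $x=x_1\cdots x_c\in\Sigma^c$ is identified with its set of position characters $\{(1,x_1),\dots,(c,x_c)\}$. $\Delta_i x_i$ denotes the symmetric difference of these sets, i.e. the set of position characters occurring an odd number of times among $x_1,\dots,x_k$; a tuple is a zero-set if this symmetric difference is empty. -}

module Defs where

open import Data.Nat using (ℕ; zero; suc; _%_; _≟_)
open import Data.Fin using (Fin)
open import Data.Fin.Properties using (all?) renaming (_≟_ to _≟ᶠ_)
open import Data.Vec using (Vec; []; _∷_; lookup; count)
open import Data.List using (List; []; _∷_; map; concatMap)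
open import Relation.Binary.PropositionalEquality using (_≡_)
open import Relation.Nullary using (Dec)

-- Alphabet Σ = Fin m (an arbitrary finite alphabet of size m).
-- A key x ∈ Σ^c is a vector of c characters; it is identified with its set of
-- position characters {(j , lookup x j) | j : Fin c}.
Key : ℕ → ℕ → Set
Key m c = Vec (Fin m) c

occ : ∀ {m c k} → Fin c → Fin m → Vec (Key m c) k → ℕ
occ j a xs = count (λ x → lookup x j ≟ᶠ a) xs

-- (x₁,…,x_k) is a zero-set iff the symmetric difference Δᵢ xᵢ is empty, i.e.
-- every position character occurs an even number of times.
ZeroSet : ∀ {m c k} → Vec (Key m c) k → Set
ZeroSet {m} {c} xs = (j : Fin c) (a : Fin m) → occ j a xs % 2 ≡ 0

zeroSet? : ∀ {m c k} (xs : Vec (Key m c) k) → Dec (ZeroSet xs)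
zeroSet? xs = all? (λ j → all? (λ a → occ j a xs % 2 ≟ 0))

tuples : ∀ {A : Set} → List A → (k : ℕ) → List (Vec A k)
tuples S zero    = [] ∷ []
tuples S (suc k) = concatMap (λ x → map (x ∷_) (tuples S k)) S

{-# OPTIONS --safe #-}
-- Split a (4 + r)-tuple as p ++ q ++ t with p, q pairs. It is a zero-set iff Δ p = Δ q ⊕ Δ t, so for
-- fixed t the number of good (p , q) is Σ_U a(U) a(U ⊕ Δ t), where a(U) is the number of pairs p with
-- Δ p = U; by Cauchy–Schwarz this is at most Σ_U a(U)², the number of zero-set 4-tuples. Hence it
-- suffices to show that there are at most 3^c n² zero-set 4-tuples.
-- For that, prove by induction on c the weighted bound W(f₁,…,f₄)² ≤ 9^c ∏ᵢ ‖fᵢ‖², where W sums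
-- f₁(x₁)⋯f₄(x₄) over all zero-set 4-tuples of keys and ‖f‖² = Σₓ f(x)². The first characters of a
-- zero-set 4-tuple are paired up in one of three ways and its tails form a zero-set, so W is bounded by
-- three double sums over the first characters a, b of W on the tails; each is handled by the induction
-- hypothesis and Cauchy–Schwarz in a and in b. For f the indicator of S, ‖f‖² = n.
module Submission where

open import Defs
open import Data.Nat using (ℕ; zero; suc; _+_; _*_; _^_; _∸_; _≤_; z≤n; s≤s; _%_; parity)
open import Data.Nat.Properties
open import Data.Nat.Tactic.RingSolver using (solve-∀)
open import Algebra.Properties.CommutativeSemigroup *-commutativeSemigroup using (interchange; x∙yz≈y∙xz)
open import Data.Bool using (true; false; if_then_else_)
open import Data.Parity.Base as ℙ using (Parity; 0ℙ; 1ℙ)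
import Data.Parity.Properties as ℙₚ
open import Data.Fin as Fin using (Fin)
open import Data.Fin.Patterns using (0F; 1F; 2F)
import Data.Fin.Properties as Finₚ
open import Data.Sum using (inj₁; inj₂)
open import Data.Product using (_×_; _,_; proj₁; proj₂; ∃-syntax)
open import Data.List using (List; []; _∷_; length; filter; map; concatMap; _++_; allFin)
open import Data.List.Relation.Unary.Any using (here; there)
open import Data.List.Relation.Unary.All using (All; []; _∷_)
open import Data.List.Relation.Unary.AllPairs using ([]; _∷_)
open import Data.List.Relation.Unary.Unique.Propositional using (Unique)
open import Data.List.Relation.Unary.Unique.Propositional.Properties using (allFin⁺)
open import Data.List.Membership.Propositional using (_∈_; lose)
open import Data.List.Membership.Propositional.Properties using (∈-map⁺; ∈-concatMap⁺; ∈-allFin)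
open import Data.Vec as Vec using (Vec; []; _∷_; zipWith; replicate; lookup; tabulate; count)
open import Data.Vec.Properties using (≡-dec; lookup∘tabulate; tabulate∘lookup; tabulate-cong; lookup-zipWith)
open import Function using (_∘_; id)
open import Relation.Binary.PropositionalEquality
open import Relation.Binary.Definitions using (DecidableEquality)
open import Relation.Nullary using (Dec; does; yes; no; ¬_; contradiction; _×-dec_)
open import Relation.Unary using (Decidable)

private variable
  A B X : Set

∑ : List A → (A → ℕ) → ℕ
∑ []       f = 0
∑ (x ∷ xs) f = f x + ∑ xs f

infix 5 ∑
syntax ∑ xs (λ x → e) = ∑[ x ∈ xs ] e

infix 8 _²

_² : ℕ → ℕ
n ² = n * n

∑-cong : (xs : List A) {f g : A → ℕ} → (∀ x → f x ≡ g x) → ∑ xs f ≡ ∑ xs g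
∑-cong []       f≗g = refl
∑-cong (x ∷ xs) f≗g = cong₂ _+_ (f≗g x) (∑-cong xs f≗g)

∑-mono-≤ : (xs : List A) {f g : A → ℕ} → (∀ x → f x ≤ g x) → ∑ xs f ≤ ∑ xs g
∑-mono-≤ []       f≤g = z≤n
∑-mono-≤ (x ∷ xs) f≤g = +-mono-≤ (f≤g x) (∑-mono-≤ xs f≤g)

∑-distrib-+ : (xs : List A) (f g : A → ℕ) → ∑[ x ∈ xs ] (f x + g x) ≡ ∑ xs f + ∑ xs g
∑-distrib-+ []       f g = refl
∑-distrib-+ (x ∷ xs) f g = trans (cong (f x + g x +_) (∑-distrib-+ xs f g)) (+-+-comm (f x) (g x) _ _)
  where
  +-+-comm : ∀ a b c d → (a + b) + (c + d) ≡ (a + c) + (b + d)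
  +-+-comm = solve-∀

*-distribˡ-∑ : (k : ℕ) (xs : List A) (f : A → ℕ) → k * ∑ xs f ≡ ∑[ x ∈ xs ] k * f x
*-distribˡ-∑ k []       f = *-zeroʳ k
*-distribˡ-∑ k (x ∷ xs) f = trans (*-distribˡ-+ k (f x) _) (cong (k * f x +_) (*-distribˡ-∑ k xs f))

*-distribʳ-∑ : (k : ℕ) (xs : List A) (f : A → ℕ) → ∑ xs f * k ≡ ∑[ x ∈ xs ] f x * k
*-distribʳ-∑ k xs f = trans (*-comm _ k) (trans (*-distribˡ-∑ k xs f) (∑-cong xs (λ x → *-comm k (f x))))

∑-const : (xs : List A) (k : ℕ) → ∑[ x ∈ xs ] k ≡ length xs * k
∑-const []       k = refl
∑-const (x ∷ xs) k = cong (k +_) (∑-const xs k)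

∑-comm : (xs : List A) (ys : List B) (f : A → B → ℕ) →
  ∑[ x ∈ xs ] ∑[ y ∈ ys ] f x y ≡ ∑[ y ∈ ys ] ∑[ x ∈ xs ] f x y
∑-comm []       ys f = sym (trans (∑-const ys 0) (*-zeroʳ (length ys)))
∑-comm (x ∷ xs) ys f = trans (cong (∑ ys (f x) +_) (∑-comm xs ys f))
  (sym (∑-distrib-+ ys (f x) (λ y → ∑[ x ∈ xs ] f x y)))

∑-++ : (xs ys : List A) (f : A → ℕ) → ∑ (xs ++ ys) f ≡ ∑ xs f + ∑ ys f
∑-++ []       ys f = refl
∑-++ (x ∷ xs) ys f = trans (cong (f x +_) (∑-++ xs ys f)) (sym (+-assoc (f x) _ _))

∑-map : (g : A → B) (xs : List A) (f : B → ℕ) → ∑ (map g xs) f ≡ ∑[ x ∈ xs ] f (g x)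
∑-map g []       f = refl
∑-map g (x ∷ xs) f = cong (f (g x) +_) (∑-map g xs f)

∑-concatMap : (g : A → List B) (xs : List A) (f : B → ℕ) →
  ∑ (concatMap g xs) f ≡ ∑[ x ∈ xs ] ∑ (g x) f
∑-concatMap g []       f = refl
∑-concatMap g (x ∷ xs) f = trans (∑-++ (g x) (concatMap g xs) f) (cong (∑ (g x) f +_) (∑-concatMap g xs f))

-- Defined through does, so that 𝟙 (map′ f g d) and 𝟙 d agree definitionally.
𝟙 : {P : Set} → Dec P → ℕ
𝟙 d = if does d then 1 else 0

𝟙-× : {P Q : Set} (p : Dec P) (q : Dec Q) → 𝟙 (p ×-dec q) ≡ 𝟙 p * 𝟙 q
𝟙-× (yes _) q = sym (+-identityʳ (𝟙 q))
𝟙-× (no _)  q = refl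

𝟙-no : {P : Set} (d : Dec P) → ¬ P → 𝟙 d ≡ 0
𝟙-no (yes p) ¬p = contradiction p ¬p
𝟙-no (no _)  ¬p = refl

𝟙-cong : {P Q : Set} → (P → Q) → (Q → P) → (p : Dec P) (q : Dec Q) → 𝟙 p ≡ 𝟙 q
𝟙-cong P⇒Q Q⇒P (yes p) (yes q) = refl
𝟙-cong P⇒Q Q⇒P (yes p) (no ¬q) = contradiction (P⇒Q p) ¬q
𝟙-cong P⇒Q Q⇒P (no ¬p) (yes q) = contradiction (Q⇒P q) ¬p
𝟙-cong P⇒Q Q⇒P (no ¬p) (no ¬q) = refl

𝟙≤*𝟙 : {P Q : Set} (p : Dec P) (q : Dec Q) {n : ℕ} → (P → Q × 1 ≤ n) → 𝟙 p ≤ n * 𝟙 q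
𝟙≤*𝟙 (no _)  q       f = z≤n
𝟙≤*𝟙 (yes p) (yes _) {n} f = subst (1 ≤_) (sym (*-identityʳ n)) (proj₂ (f p))
𝟙≤*𝟙 (yes p) (no ¬q) f = contradiction (proj₁ (f p)) ¬q

length-filter≡∑𝟙 : {P : A → Set} (P? : Decidable P) (xs : List A) →
  length (filter P? xs) ≡ ∑[ x ∈ xs ] 𝟙 (P? x)
length-filter≡∑𝟙 P? []       = refl
length-filter≡∑𝟙 P? (x ∷ xs) with P? x
... | yes _ = cong suc (length-filter≡∑𝟙 P? xs)
... | no _  = length-filter≡∑𝟙 P? xs

-- Cauchy–Schwarz

x≤y⇒2xy≤x²+y² : ∀ {x y} → x ≤ y → 2 * (x * y) ≤ x ² + y ²
x≤y⇒2xy≤x²+y² {x} x≤y = subst (λ y → 2 * (x * y) ≤ x ² + y ²) (m+[n∸m]≡n x≤y) (gap x _)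
  where
  square-gap : ∀ x d → 2 * (x * (x + d)) + d * d ≡ x * x + (x + d) * (x + d)
  square-gap = solve-∀
  gap : ∀ x d → 2 * (x * (x + d)) ≤ x ² + (x + d) ²
  gap x d = subst (2 * (x * (x + d)) ≤_) (square-gap x d) (m≤m+n _ (d ²))

2xy≤x²+y² : ∀ x y → 2 * (x * y) ≤ x ² + y ²
2xy≤x²+y² x y with ≤-total x y
... | inj₁ x≤y = x≤y⇒2xy≤x²+y² x≤y
... | inj₂ y≤x = subst₂ (λ a b → 2 * a ≤ b) (*-comm y x) (+-comm (y ²) (x ²)) (x≤y⇒2xy≤x²+y² y≤x)

4xy≤[x+y]² : ∀ x y → 4 * (x * y) ≤ (x + y) ²
4xy≤[x+y]² x y = begin
  4 * (x * y)                        ≡⟨ double x y ⟩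
  2 * (x * y) + 2 * (x * y)          ≤⟨ +-monoʳ-≤ (2 * (x * y)) (2xy≤x²+y² x y) ⟩
  2 * (x * y) + (x ² + y ²)          ≡⟨ square-sum x y ⟩
  (x + y) ²                          ∎
  where
  open ≤-Reasoning
  double : ∀ x y → 4 * (x * y) ≡ 2 * (x * y) + 2 * (x * y)
  double = solve-∀
  square-sum : ∀ x y → 2 * (x * y) + (x * x + y * y) ≡ (x + y) * (x + y)
  square-sum = solve-∀

m²≤n²⇒m≤n : ∀ m n → m ² ≤ n ² → m ≤ n
m²≤n²⇒m≤n m n m²≤n² = ≮⇒≥ (λ n<m → <⇒≱ (*-mono-< n<m n<m) m²≤n²)

cauchy-schwarz : (I : List A) (z p q : A → ℕ) → (∀ i → z i ² ≤ p i * q i) →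
  (∑ I z) ² ≤ ∑ I p * ∑ I q
cauchy-schwarz []      z p q z²≤pq = z≤n
cauchy-schwarz (i ∷ I) z p q z²≤pq = begin
  (a + b) ²                             ≡⟨ square-sum a b ⟩
  a ² + b ² + 2 * (a * b)               ≤⟨ +-mono-≤ (+-mono-≤ (z²≤pq i) ih) cross ⟩
  P * Q + P′ * Q′ + (P * Q′ + P′ * Q)   ≡⟨ expand P P′ Q Q′ ⟩
  (P + P′) * (Q + Q′)                   ∎
  where
  open ≤-Reasoning
  a = z i ; b = ∑ I z ; P = p i ; P′ = ∑ I p ; Q = q i ; Q′ = ∑ I q
  ih : b ² ≤ P′ * Q′
  ih = cauchy-schwarz I z p q z²≤pq
  square-sum : ∀ a b → (a + b) * (a + b) ≡ a * a + b * b + 2 * (a * b)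
  square-sum = solve-∀
  expand : ∀ P P′ Q Q′ → P * Q + P′ * Q′ + (P * Q′ + P′ * Q) ≡ (P + P′) * (Q + Q′)
  expand = solve-∀
  cross : 2 * (a * b) ≤ P * Q′ + P′ * Q
  cross = m²≤n²⇒m≤n _ _ (begin
    (2 * (a * b)) ²           ≡⟨ lhs a b ⟩
    4 * (a ² * b ²)           ≤⟨ *-monoʳ-≤ 4 (*-mono-≤ (z²≤pq i) ih) ⟩
    4 * (P * Q * (P′ * Q′))   ≡⟨ rhs P P′ Q Q′ ⟩
    4 * (P * Q′ * (P′ * Q))   ≤⟨ 4xy≤[x+y]² (P * Q′) (P′ * Q) ⟩
    (P * Q′ + P′ * Q) ²       ∎)
    where
    lhs : ∀ a b → (2 * (a * b)) * (2 * (a * b)) ≡ 4 * (a * a * (b * b))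
    lhs = solve-∀
    rhs : ∀ P P′ Q Q′ → 4 * (P * Q * (P′ * Q′)) ≡ 4 * (P * Q′ * (P′ * Q))
    rhs = solve-∀

cauchy-schwarz₂ : (I : List A) (J : List B) (Z : A → B → ℕ) (K : ℕ) (u₁ u₂ : A → ℕ) (v₁ v₂ : B → ℕ) →
  (∀ i j → Z i j ² ≤ K * ((u₁ i * u₂ i) * (v₁ j * v₂ j))) →
  (∑[ i ∈ I ] ∑[ j ∈ J ] Z i j) ² ≤ K * ((∑ I u₁ * ∑ I u₂) * (∑ J v₁ * ∑ J v₂))
cauchy-schwarz₂ I J Z K u₁ u₂ v₁ v₂ Z²≤ = begin
  (∑[ i ∈ I ] ∑ J (Z i)) ²          ≤⟨ cauchy-schwarz I _ (λ i → K * V * u₁ i) u₂ row ⟩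
  (∑[ i ∈ I ] K * V * u₁ i) * ∑ I u₂ ≡⟨ cong (_* ∑ I u₂) (*-distribˡ-∑ (K * V) I u₁) ⟨
  K * V * ∑ I u₁ * ∑ I u₂           ≡⟨ regroup K V (∑ I u₁) (∑ I u₂) ⟩
  K * ((∑ I u₁ * ∑ I u₂) * V)       ∎
  where
  open ≤-Reasoning
  V = ∑ J v₁ * ∑ J v₂
  regroup : ∀ K V a b → K * V * a * b ≡ K * (a * b * V)
  regroup = solve-∀
  row : ∀ i → (∑ J (Z i)) ² ≤ K * V * u₁ i * u₂ i
  row i = begin
    (∑ J (Z i)) ²                      ≤⟨ cauchy-schwarz J (Z i) (λ j → K * U * v₁ j) v₂ entry ⟩
    (∑[ j ∈ J ] K * U * v₁ j) * ∑ J v₂ ≡⟨ cong (_* ∑ J v₂) (*-distribˡ-∑ (K * U) J v₁) ⟨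
    K * U * ∑ J v₁ * ∑ J v₂           ≡⟨ swap K (u₁ i) (u₂ i) (∑ J v₁) (∑ J v₂) ⟩
    K * V * u₁ i * u₂ i               ∎
    where
    U = u₁ i * u₂ i
    entry : ∀ j → Z i j ² ≤ K * U * v₁ j * v₂ j
    entry j = ≤-trans (Z²≤ i j) (≤-reflexive (*-assoc-4 K U (v₁ j) (v₂ j)))
      where
      *-assoc-4 : ∀ K U x y → K * (U * (x * y)) ≡ K * U * x * y
      *-assoc-4 = solve-∀
    swap : ∀ K a b s t → K * (a * b) * s * t ≡ K * (s * t) * a * b
    swap = solve-∀

module _ {A : Set} (_≟_ : DecidableEquality A) where

  multiplicity : List A → A → ℕ
  multiplicity xs y = ∑[ x ∈ xs ] 𝟙 (y ≟ x)

  record Enumerates (E : List A) : Set where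
    constructor lists-once
    field multiplicity≡1 : ∀ y → multiplicity E y ≡ 1

  𝟙-≟-sym : ∀ x y → 𝟙 (x ≟ y) ≡ 𝟙 (y ≟ x)
  𝟙-≟-sym x y = 𝟙-cong sym sym (x ≟ y) (y ≟ x)

  𝟙-≟-subst : ∀ x y (h : A → ℕ) → 𝟙 (x ≟ y) * h x ≡ 𝟙 (x ≟ y) * h y
  𝟙-≟-subst x y h with x ≟ y
  ... | yes refl = refl
  ... | no _     = refl

  𝟙-≟-refl : ∀ x → 𝟙 (x ≟ x) ≡ 1
  𝟙-≟-refl x with x ≟ x
  ... | yes _  = refl
  ... | no x≢x = contradiction refl x≢x

  ∈⇒1≤multiplicity : ∀ {y xs} → y ∈ xs → 1 ≤ multiplicity xs y
  ∈⇒1≤multiplicity {y} (here refl) = ≤-trans (≤-reflexive (sym (𝟙-≟-refl y))) (m≤m+n _ _)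
  ∈⇒1≤multiplicity {y} {x ∷ _} (there y∈xs) = ≤-trans (∈⇒1≤multiplicity y∈xs) (m≤n+m _ (𝟙 (y ≟ x)))

  ∉⇒multiplicity≡0 : ∀ {y xs} → All (y ≢_) xs → multiplicity xs y ≡ 0
  ∉⇒multiplicity≡0 []           = refl
  ∉⇒multiplicity≡0 (y≢x ∷ y∉xs) = cong₂ _+_ (𝟙-no (_ ≟ _) y≢x) (∉⇒multiplicity≡0 y∉xs)

  unique⇒multiplicity≤1 : ∀ {xs} → Unique xs → ∀ y → multiplicity xs y ≤ 1
  unique⇒multiplicity≤1 []                 y = z≤n
  unique⇒multiplicity≤1 {x ∷ xs} (x∉xs ∷ u) y with y ≟ x
  ... | yes refl = s≤s (≤-reflexive (∉⇒multiplicity≡0 x∉xs))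
  ... | no _     = unique⇒multiplicity≤1 u y

  unique⇒enumerates : ∀ {E} → Unique E → (∀ y → y ∈ E) → Enumerates E
  unique⇒enumerates u complete = lists-once λ y →
    ≤-antisym (unique⇒multiplicity≤1 u y) (∈⇒1≤multiplicity (complete y))

  module _ {E : List A} (enum : Enumerates E) where

    open Enumerates enum

    ∑-sift : ∀ y (h : A → ℕ) → ∑[ x ∈ E ] 𝟙 (y ≟ x) * h x ≡ h y
    ∑-sift y h = begin
      ∑[ x ∈ E ] 𝟙 (y ≟ x) * h x  ≡⟨ ∑-cong E (λ x → 𝟙-≟-subst y x h) ⟨
      ∑[ x ∈ E ] 𝟙 (y ≟ x) * h y  ≡⟨ *-distribʳ-∑ (h y) E _ ⟨
      multiplicity E y * h y      ≡⟨ cong (_* h y) (multiplicity≡1 y) ⟩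
      1 * h y                     ≡⟨ *-identityˡ (h y) ⟩
      h y                         ∎
      where open ≡-Reasoning

    ∑-via-multiplicity : (L : List A) (g : A → ℕ) → ∑ L g ≡ ∑[ x ∈ E ] multiplicity L x * g x
    ∑-via-multiplicity L g = begin
      ∑ L g                                    ≡⟨ ∑-cong L (λ y → ∑-sift y g) ⟨
      ∑[ y ∈ L ] ∑[ x ∈ E ] 𝟙 (y ≟ x) * g x    ≡⟨ ∑-comm L E _ ⟩
      ∑[ x ∈ E ] ∑[ y ∈ L ] 𝟙 (y ≟ x) * g x    ≡⟨ ∑-cong E (λ x → *-distribʳ-∑ (g x) L _) ⟨
      ∑[ x ∈ E ] (∑[ y ∈ L ] 𝟙 (y ≟ x)) * g x  ≡⟨ ∑-cong E (λ x → cong (_* g x) (∑-cong L (λ y → 𝟙-≟-sym y x))) ⟩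
      ∑[ x ∈ E ] multiplicity L x * g x        ∎
      where open ≡-Reasoning

    ∑-involution : (σ : A → A) → (∀ x → σ (σ x) ≡ x) → (g : A → ℕ) → ∑[ x ∈ E ] g (σ x) ≡ ∑ E g
    ∑-involution σ σσ≗id g = begin
      ∑[ x ∈ E ] g (σ x)                         ≡⟨ ∑-map σ E g ⟨
      ∑ (map σ E) g                              ≡⟨ ∑-via-multiplicity (map σ E) g ⟩
      ∑[ x ∈ E ] multiplicity (map σ E) x * g x  ≡⟨ ∑-cong E (λ x → cong (_* g x) (multiplicity-σ x)) ⟩
      ∑[ x ∈ E ] 1 * g x                         ≡⟨ ∑-cong E (λ x → *-identityˡ (g x)) ⟩
      ∑ E g                                      ∎
      where
      open ≡-Reasoning
      x≡σy⇔σx≡y : ∀ x y → 𝟙 (x ≟ σ y) ≡ 𝟙 (σ x ≟ y)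
      x≡σy⇔σx≡y x y = 𝟙-cong (λ x≡σy → trans (cong σ x≡σy) (σσ≗id y))
                              (λ σx≡y → trans (sym (σσ≗id x)) (cong σ σx≡y)) (x ≟ σ y) (σ x ≟ y)
      multiplicity-σ : ∀ x → multiplicity (map σ E) x ≡ 1
      multiplicity-σ x = begin
        multiplicity (map σ E) x    ≡⟨ ∑-map σ E _ ⟩
        ∑[ y ∈ E ] 𝟙 (x ≟ σ y)      ≡⟨ ∑-cong E (x≡σy⇔σx≡y x) ⟩
        multiplicity E (σ x)        ≡⟨ multiplicity≡1 (σ x) ⟩
        1                           ∎

    ∑∑𝟙≡∑-classes : (P : List X) (h : X → A) (τ : A → A) →
      ∑[ p ∈ P ] ∑[ q ∈ P ] 𝟙 (h p ≟ τ (h q)) ≡ ∑[ U ∈ E ] multiplicity (map h P) U * multiplicity (map h P) (τ U)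
    ∑∑𝟙≡∑-classes P h τ = begin
      ∑[ p ∈ P ] ∑[ q ∈ P ] 𝟙 (h p ≟ τ (h q))  ≡⟨ ∑-comm P P _ ⟩
      ∑[ q ∈ P ] ∑[ p ∈ P ] 𝟙 (h p ≟ τ (h q))  ≡⟨ ∑-cong P (λ q → ∑-cong P (λ p → 𝟙-≟-sym _ _)) ⟩
      ∑[ q ∈ P ] ∑[ p ∈ P ] 𝟙 (τ (h q) ≟ h p)  ≡⟨ ∑-cong P (λ q → ∑-map h P _) ⟨
      ∑[ q ∈ P ] a (τ (h q))                   ≡⟨ ∑-map h P _ ⟨
      ∑[ V ∈ map h P ] a (τ V)                 ≡⟨ ∑-via-multiplicity (map h P) _ ⟩
      ∑[ U ∈ E ] a U * a (τ U)                 ∎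
      where
      open ≡-Reasoning
      a = multiplicity (map h P)

    class-cauchy-schwarz : (P : List X) (h : X → A) (σ : A → A) → (∀ x → σ (σ x) ≡ x) →
      ∑[ p ∈ P ] ∑[ q ∈ P ] 𝟙 (h p ≟ σ (h q)) ≤ ∑[ p ∈ P ] ∑[ q ∈ P ] 𝟙 (h p ≟ h q)
    class-cauchy-schwarz P h σ σσ≗id = subst₂ _≤_ (sym (∑∑𝟙≡∑-classes P h σ)) (sym (∑∑𝟙≡∑-classes P h (λ U → U)))
      (*-cancelˡ-≤ 2 (begin
        2 * (∑[ U ∈ E ] a U * a (σ U))         ≡⟨ *-distribˡ-∑ 2 E _ ⟩
        ∑[ U ∈ E ] 2 * (a U * a (σ U))         ≤⟨ ∑-mono-≤ E (λ U → 2xy≤x²+y² (a U) (a (σ U))) ⟩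
        ∑[ U ∈ E ] a U ² + a (σ U) ²           ≡⟨ ∑-distrib-+ E _ _ ⟩
        Q + (∑[ U ∈ E ] a (σ U) ²)             ≡⟨ cong (Q +_) (∑-involution σ σσ≗id (λ U → a U ²)) ⟩
        Q + Q                                  ≡⟨ cong (Q +_) (+-identityʳ Q) ⟨
        2 * (∑[ U ∈ E ] a U * a U)             ∎))
      where
      open ≤-Reasoning
      a = multiplicity (map h P)
      Q = ∑[ U ∈ E ] a U ²

∑-tuples-suc : (L : List A) (k : ℕ) (f : Vec A (suc k) → ℕ) →
  ∑ (tuples L (suc k)) f ≡ ∑[ x ∈ L ] ∑[ xs ∈ tuples L k ] f (x ∷ xs)
∑-tuples-suc L k f = trans (∑-concatMap _ L f) (∑-cong L (λ x → ∑-map (x ∷_) (tuples L k) f))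

∑-tuples-+ : (L : List A) (i j : ℕ) (f : Vec A (i + j) → ℕ) →
  ∑ (tuples L (i + j)) f ≡ ∑[ u ∈ tuples L i ] ∑[ v ∈ tuples L j ] f (u Vec.++ v)
∑-tuples-+ L zero    j f = sym (+-identityʳ _)
∑-tuples-+ L (suc i) j f = begin
  ∑ (tuples L (suc i + j)) f
    ≡⟨ ∑-tuples-suc L (i + j) f ⟩
  ∑[ x ∈ L ] ∑[ w ∈ tuples L (i + j) ] f (x ∷ w)
    ≡⟨ ∑-cong L (λ x → ∑-tuples-+ L i j (λ w → f (x ∷ w))) ⟩
  ∑[ x ∈ L ] ∑[ u ∈ tuples L i ] ∑[ v ∈ tuples L j ] f (x ∷ u Vec.++ v)
    ≡⟨ ∑-tuples-suc L i _ ⟨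
  ∑[ u ∈ tuples L (suc i) ] ∑[ v ∈ tuples L j ] f (u Vec.++ v)
    ∎
  where open ≡-Reasoning

∑-tuples-transpose : (L : List A) (c k : ℕ) (f : Vec (Vec A (suc c)) k → ℕ) →
  ∑ (tuples (tuples L (suc c)) k) f ≡ ∑[ as ∈ tuples L k ] ∑[ ts ∈ tuples (tuples L c) k ] f (zipWith _∷_ as ts)
∑-tuples-transpose L c zero    f = sym (+-identityʳ _)
∑-tuples-transpose L c (suc k) f = begin
  ∑ (tuples (tuples L (suc c)) (suc k)) f
    ≡⟨ ∑-tuples-suc (tuples L (suc c)) k f ⟩
  ∑[ x ∈ tuples L (suc c) ] ∑[ xs ∈ tuples (tuples L (suc c)) k ] f (x ∷ xs)
    ≡⟨ ∑-cong (tuples L (suc c)) (λ x → ∑-tuples-transpose L c k (λ xs → f (x ∷ xs))) ⟩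
  ∑[ x ∈ tuples L (suc c) ] ∑[ as ∈ Lᵏ ] ∑[ ts ∈ Tᵏ ] f (x ∷ zipWith _∷_ as ts)
    ≡⟨ ∑-tuples-suc L c _ ⟩
  ∑[ a ∈ L ] ∑[ t ∈ T ] ∑[ as ∈ Lᵏ ] ∑[ ts ∈ Tᵏ ] f ((a ∷ t) ∷ zipWith _∷_ as ts)
    ≡⟨ ∑-cong L (λ a → trans (∑-comm T Lᵏ _) (∑-cong Lᵏ (λ as → sym (∑-tuples-suc T k _)))) ⟩
  ∑[ a ∈ L ] ∑[ as ∈ Lᵏ ] ∑[ ts ∈ tuples T (suc k) ] f (zipWith _∷_ (a ∷ as) ts)
    ≡⟨ ∑-tuples-suc L k _ ⟨
  ∑[ as ∈ tuples L (suc k) ] ∑[ ts ∈ tuples T (suc k) ] f (zipWith _∷_ as ts)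
    ∎
  where
  open ≡-Reasoning
  T = tuples L c
  Lᵏ = tuples L k
  Tᵏ = tuples T k

length≡∑1 : (xs : List A) → length xs ≡ ∑[ x ∈ xs ] 1
length≡∑1 xs = sym (trans (∑-const xs 1) (*-identityʳ _))

length-tuples : (L : List A) (k : ℕ) → length (tuples L k) ≡ length L ^ k
length-tuples L zero    = refl
length-tuples L (suc k) = begin
  length (tuples L (suc k))              ≡⟨ length≡∑1 (tuples L (suc k)) ⟩
  ∑[ xs ∈ tuples L (suc k) ] 1           ≡⟨ ∑-tuples-suc L k _ ⟩
  ∑[ x ∈ L ] ∑[ xs ∈ tuples L k ] 1      ≡⟨ ∑-cong L (λ _ → length≡∑1 (tuples L k)) ⟨
  ∑[ x ∈ L ] length (tuples L k)         ≡⟨ ∑-const L _ ⟩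
  length L * length (tuples L k)         ≡⟨ cong (length L *_) (length-tuples L k) ⟩
  length L ^ suc k                       ∎
  where open ≡-Reasoning

weight : {k : ℕ} → Vec (A → ℕ) k → Vec A k → ℕ
weight []       []       = 1
weight (f ∷ fs) (x ∷ xs) = f x * weight fs xs

shift : ∀ {c k} → Vec A k → Vec (Vec A (suc c) → ℕ) k → Vec (Vec A c → ℕ) k
shift = zipWith (λ a f → f ∘ (a ∷_))

weight-zipWith-∷ : ∀ {c k} (fs : Vec (Vec A (suc c) → ℕ) k) (as : Vec A k) (ts : Vec (Vec A c) k) →
  weight fs (zipWith _∷_ as ts) ≡ weight (shift as fs) ts
weight-zipWith-∷ []       []       []       = refl
weight-zipWith-∷ (f ∷ fs) (a ∷ as) (t ∷ ts) = cong (f (a ∷ t) *_) (weight-zipWith-∷ fs as ts)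

module _ {A : Set} (_≟_ : DecidableEquality A) (L : List A) where

  multiplicity-tuples : ∀ {k} (xs : Vec A k) →
    multiplicity (≡-dec _≟_) (tuples L k) xs ≡ weight (replicate k (multiplicity _≟_ L)) xs
  multiplicity-tuples []       = refl
  multiplicity-tuples {suc k} (y ∷ ys) = begin
    multiplicity (≡-dec _≟_) (tuples L (suc k)) (y ∷ ys)
      ≡⟨ ∑-tuples-suc L k _ ⟩
    ∑[ x ∈ L ] ∑[ xs ∈ tuples L k ] 𝟙 (y ≟ x ×-dec ≡-dec _≟_ ys xs)
      ≡⟨ ∑-cong L (λ x → ∑-cong (tuples L k) (λ xs → 𝟙-× (y ≟ x) (≡-dec _≟_ ys xs))) ⟩
    ∑[ x ∈ L ] ∑[ xs ∈ tuples L k ] 𝟙 (y ≟ x) * 𝟙 (≡-dec _≟_ ys xs)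
      ≡⟨ ∑-cong L (λ x → *-distribˡ-∑ (𝟙 (y ≟ x)) (tuples L k) _) ⟨
    ∑[ x ∈ L ] 𝟙 (y ≟ x) * multiplicity (≡-dec _≟_) (tuples L k) ys
      ≡⟨ *-distribʳ-∑ _ L _ ⟨
    multiplicity _≟_ L y * multiplicity (≡-dec _≟_) (tuples L k) ys
      ≡⟨ cong (multiplicity _≟_ L y *_) (multiplicity-tuples ys) ⟩
    weight (replicate (suc k) (multiplicity _≟_ L)) (y ∷ ys)
      ∎
    where open ≡-Reasoning

  enumerates-tuples : Enumerates _≟_ L → ∀ k → Enumerates (≡-dec _≟_) (tuples L k)
  enumerates-tuples (lists-once enum) k = lists-once λ xs → trans (multiplicity-tuples xs) (weight-1 xs)
    where
    weight-1 : ∀ {k} (xs : Vec A k) → weight (replicate k (multiplicity _≟_ L)) xs ≡ 1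
    weight-1 []       = refl
    weight-1 (x ∷ xs) = cong₂ _*_ (enum x) (weight-1 xs)

count-++ : {P : A → Set} (P? : Decidable P) {i j : ℕ} (xs : Vec A i) (ys : Vec A j) →
  count P? (xs Vec.++ ys) ≡ count P? xs + count P? ys
count-++ P? []       ys = refl
count-++ P? (x ∷ xs) ys with does (P? x)
... | true  = cong suc (count-++ P? xs ys)
... | false = count-++ P? xs ys

module _ {P : A → Set} (P? : Decidable P) where

  count-yes : ∀ {x k} (xs : Vec A k) → P x → count P? (x ∷ xs) ≡ suc (count P? xs)
  count-yes {x} _ px with P? x
  ... | yes _  = refl
  ... | no ¬px = contradiction px ¬px

  count-no : ∀ {x k} (xs : Vec A k) → ¬ P x → count P? (x ∷ xs) ≡ count P? xs
  count-no {x} _ ¬px with P? x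
  ... | yes px = contradiction px ¬px
  ... | no _   = refl

  count-swap : ∀ {i j} (xs : Vec A i) x y (ys : Vec A j) →
    count P? (xs Vec.++ x ∷ y ∷ ys) ≡ count P? (xs Vec.++ y ∷ x ∷ ys)
  count-swap (z ∷ xs) x y ys = cong (if does (P? z) then suc else id) (count-swap xs x y ys)
  count-swap []       x y ys with does (P? x) | does (P? y)
  ... | true  | true  = refl
  ... | true  | false = refl
  ... | false | true  = refl
  ... | false | false = refl

  count-double-%2 : ∀ {k} x (xs : Vec A k) → count P? (x ∷ x ∷ xs) % 2 ≡ count P? xs % 2
  count-double-%2 x xs with does (P? x)
  ... | true  = refl
  ... | false = refl

parity≡0ℙ⇒%2≡0 : ∀ n → parity n ≡ 0ℙ → n % 2 ≡ 0
parity≡0ℙ⇒%2≡0 zero          _  = refl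
parity≡0ℙ⇒%2≡0 (suc zero)    ()
parity≡0ℙ⇒%2≡0 (suc (suc n)) eq = parity≡0ℙ⇒%2≡0 n eq

%2≡0⇒parity≡0ℙ : ∀ n → n % 2 ≡ 0 → parity n ≡ 0ℙ
%2≡0⇒parity≡0ℙ zero          _  = refl
%2≡0⇒parity≡0ℙ (suc zero)    ()
%2≡0⇒parity≡0ℙ (suc (suc n)) eq = %2≡0⇒parity≡0ℙ n eq

p+q≡0ℙ⇒p≡q : ∀ p q → p ℙ.+ q ≡ 0ℙ → p ≡ q
p+q≡0ℙ⇒p≡q 0ℙ 0ℙ _ = refl
p+q≡0ℙ⇒p≡q 1ℙ 1ℙ _ = refl

-- A set of position characters is stored as its ℤ/2-valued indicator, indexed by position and then
-- character; Δ xs is the paper's Δᵢ xᵢ.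
PosCharSet : ℕ → ℕ → Set
PosCharSet m c = Vec (Vec Parity m) c

module _ {m c : ℕ} where

  Δ : {k : ℕ} → Vec (Key m c) k → PosCharSet m c
  Δ xs = tabulate λ j → tabulate λ a → parity (occ j a xs)

  infixl 6 _⊕_

  _⊕_ : PosCharSet m c → PosCharSet m c → PosCharSet m c
  _⊕_ = zipWith (zipWith ℙ._+_)

  entry : PosCharSet m c → Fin c → Fin m → Parity
  entry u j a = lookup (lookup u j) a

  PosCharSet-ext : {u v : PosCharSet m c} →
    (∀ j a → entry u j a ≡ entry v j a) → u ≡ v
  PosCharSet-ext {u} {v} eq = trans (sym (tabulate∘lookup u)) (trans (tabulate-cong (λ j →
    trans (sym (tabulate∘lookup (lookup u j))) (trans (tabulate-cong (eq j)) (tabulate∘lookup (lookup v j)))))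
    (tabulate∘lookup v))

  entry-Δ : ∀ {k} (xs : Vec (Key m c) k) j a → entry (Δ xs) j a ≡ parity (occ j a xs)
  entry-Δ xs j a = trans (cong (λ row → lookup row a) (lookup∘tabulate _ j)) (lookup∘tabulate _ a)

  entry-⊕ : ∀ u v j a → entry (u ⊕ v) j a ≡ entry u j a ℙ.+ entry v j a
  entry-⊕ u v j a = trans (cong (λ row → lookup row a) (lookup-zipWith _ j u v))
                           (lookup-zipWith ℙ._+_ a (lookup u j) (lookup v j))

  Δ-++ : ∀ {i k} (p : Vec (Key m c) i) (r : Vec (Key m c) k) → Δ (p Vec.++ r) ≡ Δ p ⊕ Δ r
  Δ-++ p r = PosCharSet-ext λ j a → begin
    entry (Δ (p Vec.++ r)) j a                                  ≡⟨ entry-Δ (p Vec.++ r) j a ⟩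
    parity (occ j a (p Vec.++ r))                               ≡⟨ cong parity (count-++ _ p r) ⟩
    parity (occ j a p + occ j a r)                              ≡⟨ ℙₚ.+-homo-+ (occ j a p) (occ j a r) ⟩
    parity (occ j a p) ℙ.+ parity (occ j a r)                   ≡⟨ cong₂ ℙ._+_ (entry-Δ p j a) (entry-Δ r j a) ⟨
    entry (Δ p) j a ℙ.+ entry (Δ r) j a                         ≡⟨ entry-⊕ (Δ p) (Δ r) j a ⟨
    entry (Δ p ⊕ Δ r) j a                                       ∎
    where open ≡-Reasoning

  ⊕-involutive : ∀ s u → (u ⊕ s) ⊕ s ≡ u
  ⊕-involutive s u = PosCharSet-ext λ j a →
    trans (entry-⊕ (u ⊕ s) s j a) (trans (cong (ℙ._+ _) (entry-⊕ u s j a)) (p+q+q≡p _ _))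
    where
    p+q+q≡p : ∀ p q → p ℙ.+ q ℙ.+ q ≡ p
    p+q+q≡p p q = trans (ℙₚ.+-assoc p q q) (trans (cong (p ℙ.+_) (ℙₚ.p+p≡0ℙ q)) (ℙₚ.+-identityʳ p))

  infix 4 _≟ᴾ_

  _≟ᴾ_ : DecidableEquality (PosCharSet m c)
  _≟ᴾ_ = ≡-dec (≡-dec ℙₚ._≟_)

  𝟙-zeroSet-++ : ∀ {i k} (p : Vec (Key m c) i) (r : Vec (Key m c) k) →
    𝟙 (zeroSet? (p Vec.++ r)) ≡ 𝟙 (Δ p ≟ᴾ Δ r)
  𝟙-zeroSet-++ p r = 𝟙-cong zero⇒Δ≡Δ Δ≡Δ⇒zero (zeroSet? (p Vec.++ r)) (Δ p ≟ᴾ Δ r)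
    where
    parity-occ-++ : ∀ j a → parity (occ j a (p Vec.++ r)) ≡ entry (Δ p) j a ℙ.+ entry (Δ r) j a
    parity-occ-++ j a = trans (sym (entry-Δ (p Vec.++ r) j a))
      (trans (cong (λ u → entry u j a) (Δ-++ p r)) (entry-⊕ (Δ p) (Δ r) j a))
    zero⇒Δ≡Δ : ZeroSet (p Vec.++ r) → Δ p ≡ Δ r
    zero⇒Δ≡Δ isZero = PosCharSet-ext λ j a →
      p+q≡0ℙ⇒p≡q _ _ (trans (sym (parity-occ-++ j a)) (%2≡0⇒parity≡0ℙ (occ j a (p Vec.++ r)) (isZero j a)))
    Δ≡Δ⇒zero : Δ p ≡ Δ r → ZeroSet (p Vec.++ r)
    Δ≡Δ⇒zero Δp≡Δr j a = parity≡0ℙ⇒%2≡0 (occ j a (p Vec.++ r)) (begin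
      parity (occ j a (p Vec.++ r))      ≡⟨ parity-occ-++ j a ⟩
      entry (Δ p) j a ℙ.+ entry (Δ r) j a    ≡⟨ cong (λ u → entry (Δ p) j a ℙ.+ entry u j a) Δp≡Δr ⟨
      entry (Δ p) j a ℙ.+ entry (Δ p) j a    ≡⟨ ℙₚ.p+p≡0ℙ (entry (Δ p) j a) ⟩
      0ℙ                                 ∎)
      where open ≡-Reasoning

  parities : List Parity
  parities = 0ℙ ∷ 1ℙ ∷ []

  posCharSets : List (PosCharSet m c)
  posCharSets = tuples (tuples parities m) c

  enumerates-posCharSets : Enumerates _≟ᴾ_ posCharSets
  enumerates-posCharSets = enumerates-tuples _ _ (enumerates-tuples ℙₚ._≟_ parities enum-parities m) c
    where
    enum-parities : Enumerates ℙₚ._≟_ parities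
    enum-parities = lists-once λ { 0ℙ → refl ; 1ℙ → refl }

-- Reduction to 4-tuples

zeroCount : ∀ {m c} → List (Key m c) → ℕ → ℕ
zeroCount S k = ∑[ xs ∈ tuples S k ] 𝟙 (zeroSet? xs)

zeroCount-reduce-to-4 : ∀ {m c} (S : List (Key m c)) (r : ℕ) → zeroCount S (4 + r) ≤ length S ^ r * zeroCount S 4
zeroCount-reduce-to-4 S r = begin
  zeroCount S (2 + (2 + r))
    ≡⟨ ∑-tuples-+ S 2 (2 + r) _ ⟩
  ∑[ p ∈ S² ] ∑[ w ∈ tuples S (2 + r) ] 𝟙 (zeroSet? (p Vec.++ w))
    ≡⟨ ∑-cong S² (λ p → ∑-tuples-+ S 2 r _) ⟩
  ∑[ p ∈ S² ] ∑[ q ∈ S² ] ∑[ t ∈ Sʳ ] 𝟙 (zeroSet? (p Vec.++ (q Vec.++ t)))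
    ≡⟨ ∑-cong S² (λ p → ∑-cong S² (λ q → ∑-cong Sʳ (λ t →
         trans (𝟙-zeroSet-++ p (q Vec.++ t)) (cong (λ u → 𝟙 (Δ p ≟ᴾ u)) (Δ-++ q t))))) ⟩
  ∑[ p ∈ S² ] ∑[ q ∈ S² ] ∑[ t ∈ Sʳ ] 𝟙 (Δ p ≟ᴾ Δ q ⊕ Δ t)
    ≡⟨ trans (∑-cong S² (λ p → ∑-comm S² Sʳ _)) (∑-comm S² Sʳ _) ⟩
  ∑[ t ∈ Sʳ ] ∑[ p ∈ S² ] ∑[ q ∈ S² ] 𝟙 (Δ p ≟ᴾ Δ q ⊕ Δ t)
    ≤⟨ ∑-mono-≤ Sʳ (λ t → class-cauchy-schwarz _≟ᴾ_ enumerates-posCharSets S² Δ (_⊕ Δ t) (⊕-involutive (Δ t))) ⟩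
  ∑[ t ∈ Sʳ ] ∑[ p ∈ S² ] ∑[ q ∈ S² ] 𝟙 (Δ p ≟ᴾ Δ q)
    ≡⟨ ∑-cong Sʳ (λ _ → zeroCount-2+2) ⟨
  ∑[ t ∈ Sʳ ] zeroCount S 4
    ≡⟨ ∑-const Sʳ _ ⟩
  length Sʳ * zeroCount S 4
    ≡⟨ cong (_* zeroCount S 4) (length-tuples S r) ⟩
  length S ^ r * zeroCount S 4
    ∎
  where
  open ≤-Reasoning
  S² = tuples S 2
  Sʳ = tuples S r
  zeroCount-2+2 : zeroCount S 4 ≡ ∑[ p ∈ S² ] ∑[ q ∈ S² ] 𝟙 (Δ p ≟ᴾ Δ q)
  zeroCount-2+2 = trans (∑-tuples-+ S 2 2 _) (∑-cong S² (λ p → ∑-cong S² (𝟙-zeroSet-++ p)))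

-- Pairings of four characters

pairing : Fin 3 → A → A → Vec A 4
pairing 0F a b = a ∷ a ∷ b ∷ b ∷ []
pairing 1F a b = a ∷ b ∷ a ∷ b ∷ []
pairing 2F a b = a ∷ b ∷ b ∷ a ∷ []

pairings : List A → List (Vec A 4)
pairings L = concatMap (λ π → concatMap (λ a → map (pairing π a) L) L) (allFin 3)

∈-pairings : ∀ {L : List A} π {a b} → a ∈ L → b ∈ L → pairing π a b ∈ pairings L
∈-pairings {L = L} π {a} a∈L b∈L = ∈-concatMap⁺ (λ π → concatMap (λ a → map (pairing π a) L) L)
  (lose (∈-allFin π) (∈-concatMap⁺ (λ a → map (pairing π a) L) (lose a∈L (∈-map⁺ (pairing π a) b∈L))))

∑-pairings : (L : List A) (f : Vec A 4 → ℕ) →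
  ∑ (pairings L) f ≡ ∑[ π ∈ allFin 3 ] ∑[ a ∈ L ] ∑[ b ∈ L ] f (pairing π a b)
∑-pairings L f = trans (∑-concatMap (λ π → concatMap (λ a → map (pairing π a) L) L) (allFin 3) f)
  (∑-cong (allFin 3) λ π → trans (∑-concatMap (λ a → map (pairing π a) L) L f)
    (∑-cong L λ a → ∑-map (pairing π a) L f))

module _ {A : Set} (_≟_ : DecidableEquality A) where

  EvenCounts : ∀ {k} → Vec A k → Set
  EvenCounts xs = ∀ a → count (_≟ a) xs % 2 ≡ 0

  evenCounts-swap : ∀ {i j} (xs : Vec A i) x y (ys : Vec A j) →
    EvenCounts (xs Vec.++ x ∷ y ∷ ys) → EvenCounts (xs Vec.++ y ∷ x ∷ ys)
  evenCounts-swap xs x y ys even a = trans (cong (_% 2) (count-swap (_≟ a) xs y x ys)) (even a)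

  evenCounts-drop-double : ∀ {k} x (xs : Vec A k) → EvenCounts (x ∷ x ∷ xs) → EvenCounts xs
  evenCounts-drop-double x xs even a = trans (sym (count-double-%2 (_≟ a) x xs)) (even a)

  evenCounts-pair : ∀ x y → EvenCounts (x ∷ y ∷ []) → x ≡ y
  evenCounts-pair x y even with y ≟ x
  ... | yes y≡x = sym y≡x
  ... | no y≢x  = contradiction (subst (λ n → n % 2 ≡ 0) count≡1 (even x)) λ ()
    where
    count≡1 : count (_≟ x) (x ∷ y ∷ []) ≡ 1
    count≡1 = trans (count-yes (_≟ x) (y ∷ []) refl) (cong suc (count-no (_≟ x) [] y≢x))

  evenCounts⇒pairing : ∀ a₁ a₂ a₃ a₄ → EvenCounts (a₁ ∷ a₂ ∷ a₃ ∷ a₄ ∷ []) →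
    ∃[ π ] ∃[ a ] ∃[ b ] a₁ ∷ a₂ ∷ a₃ ∷ a₄ ∷ [] ≡ pairing π a b
  evenCounts⇒pairing a₁ a₂ a₃ a₄ even with a₂ ≟ a₁ | a₃ ≟ a₁ | a₄ ≟ a₁
  ... | yes refl | _ | _ =
    0F , a₁ , a₃ , cong (λ b → a₁ ∷ a₁ ∷ a₃ ∷ b ∷ []) (sym (evenCounts-pair a₃ a₄
      (evenCounts-drop-double a₁ (a₃ ∷ a₄ ∷ []) even)))
  ... | no _ | yes refl | _ =
    1F , a₁ , a₂ , cong (λ b → a₁ ∷ a₂ ∷ a₁ ∷ b ∷ []) (sym (evenCounts-pair a₂ a₄
      (evenCounts-drop-double a₁ (a₂ ∷ a₄ ∷ []) (evenCounts-swap (a₁ ∷ []) a₂ a₁ (a₄ ∷ []) even))))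
  ... | no _ | no _ | yes refl =
    2F , a₁ , a₂ , cong (λ b → a₁ ∷ a₂ ∷ b ∷ a₁ ∷ []) (sym (evenCounts-pair a₂ a₃
      (evenCounts-drop-double a₁ (a₂ ∷ a₃ ∷ []) (evenCounts-swap (a₁ ∷ []) a₂ a₁ (a₃ ∷ [])
        (evenCounts-swap (a₁ ∷ a₂ ∷ []) a₃ a₁ [] even)))))
  ... | no a₂≢a₁ | no a₃≢a₁ | no a₄≢a₁ = contradiction (subst (λ n → n % 2 ≡ 0) count≡1 (even a₁)) λ ()
    where
    count≡1 : count (_≟ a₁) (a₁ ∷ a₂ ∷ a₃ ∷ a₄ ∷ []) ≡ 1
    count≡1 = trans (count-yes (_≟ a₁) (a₂ ∷ a₃ ∷ a₄ ∷ []) refl)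
      (cong suc (trans (count-no (_≟ a₁) (a₃ ∷ a₄ ∷ []) a₂≢a₁)
        (trans (count-no (_≟ a₁) (a₄ ∷ []) a₃≢a₁) (count-no (_≟ a₁) [] a₄≢a₁))))

  evenCounts⇒∈pairings : ∀ {L} → (∀ a → a ∈ L) → (as : Vec A 4) → EvenCounts as → as ∈ pairings L
  evenCounts⇒∈pairings {L} complete (a₁ ∷ a₂ ∷ a₃ ∷ a₄ ∷ []) even =
    let π , a , b , as≡ = evenCounts⇒pairing a₁ a₂ a₃ a₄ even
    in subst (_∈ pairings L) (sym as≡) (∈-pairings π (complete a) (complete b))

-- Zero-set 4-tuples of keys

module _ {m : ℕ} where

  keys : (c : ℕ) → List (Key m c)
  keys c = tuples (allFin m) c

  _≟ᵛ_ : ∀ {c} → DecidableEquality (Vec (Fin m) c)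
  _≟ᵛ_ = ≡-dec Finₚ._≟_

  enumerates-allFin : Enumerates Finₚ._≟_ (allFin m)
  enumerates-allFin = unique⇒enumerates Finₚ._≟_ (allFin⁺ m) ∈-allFin

  enumerates-keys : ∀ c → Enumerates _≟ᵛ_ (keys c)
  enumerates-keys = enumerates-tuples Finₚ._≟_ (allFin m) enumerates-allFin

  module _ {c : ℕ} where

    occ-0F-zipWith-∷ : ∀ {k} (as : Vec (Fin m) k) (ts : Vec (Key m c) k) a →
      occ 0F a (zipWith _∷_ as ts) ≡ count (Finₚ._≟ a) as
    occ-0F-zipWith-∷ []       []       a = refl
    occ-0F-zipWith-∷ (b ∷ as) (t ∷ ts) a =
      cong (if does (b Finₚ.≟ a) then suc else id) (occ-0F-zipWith-∷ as ts a)

    occ-suc-zipWith-∷ : ∀ {k} (as : Vec (Fin m) k) (ts : Vec (Key m c) k) j a →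
      occ (Fin.suc j) a (zipWith _∷_ as ts) ≡ occ j a ts
    occ-suc-zipWith-∷ []       []       j a = refl
    occ-suc-zipWith-∷ (b ∷ as) (t ∷ ts) j a =
      cong (if does (lookup t j Finₚ.≟ a) then suc else id) (occ-suc-zipWith-∷ as ts j a)

    zeroSet-heads : ∀ {k} (as : Vec (Fin m) k) (ts : Vec (Key m c) k) →
      ZeroSet (zipWith _∷_ as ts) → EvenCounts Finₚ._≟_ as
    zeroSet-heads as ts isZero a = trans (cong (_% 2) (sym (occ-0F-zipWith-∷ as ts a))) (isZero 0F a)

    zeroSet-tails : ∀ {k} (as : Vec (Fin m) k) (ts : Vec (Key m c) k) →
      ZeroSet (zipWith _∷_ as ts) → ZeroSet ts
    zeroSet-tails as ts isZero j a =
      trans (cong (_% 2) (sym (occ-suc-zipWith-∷ as ts j a))) (isZero (Fin.suc j) a)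

    𝟙-zeroSet-zipWith-∷ : (as : Vec (Fin m) 4) (ts : Vec (Key m c) 4) →
      𝟙 (zeroSet? (zipWith _∷_ as ts)) ≤ multiplicity _≟ᵛ_ (pairings (allFin m)) as * 𝟙 (zeroSet? ts)
    𝟙-zeroSet-zipWith-∷ as ts = 𝟙≤*𝟙 (zeroSet? (zipWith _∷_ as ts)) (zeroSet? ts) λ isZero →
      zeroSet-tails as ts isZero ,
      ∈⇒1≤multiplicity _≟ᵛ_ (evenCounts⇒∈pairings Finₚ._≟_ ∈-allFin as (zeroSet-heads as ts isZero))

  zeroWeight : ∀ {c k} → Vec (Key m c → ℕ) k → ℕ
  zeroWeight {c} {k} fs = ∑[ xs ∈ tuples (keys c) k ] weight fs xs * 𝟙 (zeroSet? xs)

  ‖_‖² : ∀ {c} → (Key m c → ℕ) → ℕ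
  ‖_‖² {c} f = ∑[ x ∈ keys c ] f x ²

  ∑‖∘∷‖² : ∀ {c} (f : Key m (suc c) → ℕ) → ∑[ a ∈ allFin m ] ‖ f ∘ (a ∷_) ‖² ≡ ‖ f ‖²
  ∑‖∘∷‖² {c} f = sym (∑-tuples-suc (allFin m) c (λ x → f x ²))

  zeroWeight-≤-pairings : ∀ {c} (fs : Vec (Key m (suc c) → ℕ) 4) →
    zeroWeight fs ≤ ∑[ π ∈ allFin 3 ] ∑[ a ∈ allFin m ] ∑[ b ∈ allFin m ] zeroWeight (shift (pairing π a b) fs)
  zeroWeight-≤-pairings {c} fs = begin
    zeroWeight fs
      ≡⟨ ∑-tuples-transpose (allFin m) c 4 _ ⟩
    ∑[ as ∈ F⁴ ] ∑[ ts ∈ K⁴ ] weight fs (zipWith _∷_ as ts) * 𝟙 (zeroSet? (zipWith _∷_ as ts))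
      ≤⟨ ∑-mono-≤ F⁴ (λ as → ∑-mono-≤ K⁴ (λ ts → term-≤ as ts)) ⟩
    ∑[ as ∈ F⁴ ] ∑[ ts ∈ K⁴ ] μ as * (weight (shift as fs) ts * 𝟙 (zeroSet? ts))
      ≡⟨ ∑-cong F⁴ (λ as → *-distribˡ-∑ (μ as) K⁴ _) ⟨
    ∑[ as ∈ F⁴ ] μ as * zeroWeight (shift as fs)
      ≡⟨ ∑-via-multiplicity _≟ᵛ_ (enumerates-keys 4) (pairings (allFin m)) _ ⟨
    ∑[ v ∈ pairings (allFin m) ] zeroWeight (shift v fs)
      ≡⟨ ∑-pairings (allFin m) _ ⟩
    ∑[ π ∈ allFin 3 ] ∑[ a ∈ allFin m ] ∑[ b ∈ allFin m ] zeroWeight (shift (pairing π a b) fs)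
      ∎
    where
    open ≤-Reasoning
    F⁴ = tuples (allFin m) 4
    K⁴ = tuples (keys c) 4
    μ = multiplicity _≟ᵛ_ (pairings (allFin m))
    term-≤ : ∀ as ts → weight fs (zipWith _∷_ as ts) * 𝟙 (zeroSet? (zipWith _∷_ as ts))
                       ≤ μ as * (weight (shift as fs) ts * 𝟙 (zeroSet? ts))
    term-≤ as ts = begin
      weight fs (zipWith _∷_ as ts) * 𝟙 (zeroSet? (zipWith _∷_ as ts))
        ≤⟨ *-mono-≤ (≤-reflexive (weight-zipWith-∷ fs as ts)) (𝟙-zeroSet-zipWith-∷ as ts) ⟩
      weight (shift as fs) ts * (μ as * 𝟙 (zeroSet? ts))
        ≡⟨ x∙yz≈y∙xz (weight (shift as fs) ts) (μ as) (𝟙 (zeroSet? ts)) ⟩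
      μ as * (weight (shift as fs) ts * 𝟙 (zeroSet? ts))
        ∎

  cauchy-schwarz-heads : ∀ {c} (Z : Fin m → Fin m → ℕ) (K : ℕ) (g₁ g₂ g₃ g₄ : Key m (suc c) → ℕ) →
    (∀ a b → Z a b ² ≤ K * ((‖ g₁ ∘ (a ∷_) ‖² * ‖ g₂ ∘ (a ∷_) ‖²) * (‖ g₃ ∘ (b ∷_) ‖² * ‖ g₄ ∘ (b ∷_) ‖²))) →
    (∑[ a ∈ allFin m ] ∑[ b ∈ allFin m ] Z a b) ² ≤ K * ((‖ g₁ ‖² * ‖ g₂ ‖²) * (‖ g₃ ‖² * ‖ g₄ ‖²))
  cauchy-schwarz-heads Z K g₁ g₂ g₃ g₄ Z²≤ = ≤-trans
    (cauchy-schwarz₂ (allFin m) (allFin m) Z K (λ a → ‖ g₁ ∘ (a ∷_) ‖²) (λ a → ‖ g₂ ∘ (a ∷_) ‖²)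
      (λ b → ‖ g₃ ∘ (b ∷_) ‖²) (λ b → ‖ g₄ ∘ (b ∷_) ‖²) Z²≤)
    (≤-reflexive (cong (K *_) (cong₂ _*_ (cong₂ _*_ (∑‖∘∷‖² g₁) (∑‖∘∷‖² g₂)) (cong₂ _*_ (∑‖∘∷‖² g₃) (∑‖∘∷‖² g₄)))))

  pairing-sum-bound : ∀ {c} (K : ℕ) →
    (∀ (g₁ g₂ g₃ g₄ : Key m c → ℕ) →
       zeroWeight (g₁ ∷ g₂ ∷ g₃ ∷ g₄ ∷ []) ² ≤ K * ((‖ g₁ ‖² * ‖ g₂ ‖²) * (‖ g₃ ‖² * ‖ g₄ ‖²))) →
    ∀ π (f₁ f₂ f₃ f₄ : Key m (suc c) → ℕ) →
    (∑[ a ∈ allFin m ] ∑[ b ∈ allFin m ] zeroWeight (shift (pairing π a b) (f₁ ∷ f₂ ∷ f₃ ∷ f₄ ∷ []))) ²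
      ≤ K * ((‖ f₁ ‖² * ‖ f₂ ‖²) * (‖ f₃ ‖² * ‖ f₄ ‖²))
  pairing-sum-bound K W²≤ 0F f₁ f₂ f₃ f₄ = cauchy-schwarz-heads _ K f₁ f₂ f₃ f₄ λ a b → W²≤ _ _ _ _
  pairing-sum-bound K W²≤ 1F f₁ f₂ f₃ f₄ = ≤-trans
    (cauchy-schwarz-heads _ K f₁ f₃ f₂ f₄ λ a b →
      ≤-trans (W²≤ _ _ _ _) (≤-reflexive (cong (K *_) (interchange (q f₁ a) (q f₂ b) (q f₃ a) (q f₄ b)))))
    (≤-reflexive (cong (K *_) (interchange ‖ f₁ ‖² ‖ f₃ ‖² ‖ f₂ ‖² ‖ f₄ ‖²)))
    where
    q : (Key m _ → ℕ) → Fin m → ℕ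
    q f a = ‖ f ∘ (a ∷_) ‖²
  pairing-sum-bound K W²≤ 2F f₁ f₂ f₃ f₄ = ≤-trans
    (cauchy-schwarz-heads _ K f₁ f₄ f₂ f₃ λ a b →
      ≤-trans (W²≤ _ _ _ _) (≤-reflexive (cong (K *_) (regroup (q f₁ a) (q f₂ b) (q f₃ b) (q f₄ a)))))
    (≤-reflexive (cong (K *_) (sym (regroup ‖ f₁ ‖² ‖ f₂ ‖² ‖ f₃ ‖² ‖ f₄ ‖²))))
    where
    q : (Key m _ → ℕ) → Fin m → ℕ
    q f a = ‖ f ∘ (a ∷_) ‖²
    regroup : ∀ x₁ x₂ x₃ x₄ → (x₁ * x₂) * (x₃ * x₄) ≡ (x₁ * x₄) * (x₂ * x₃)
    regroup x₁ x₂ x₃ x₄ = trans (cong (x₁ * x₂ *_) (*-comm x₃ x₄)) (interchange x₁ x₂ x₄ x₃)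

  zeroWeight-bound : ∀ c (f₁ f₂ f₃ f₄ : Key m c → ℕ) →
    zeroWeight (f₁ ∷ f₂ ∷ f₃ ∷ f₄ ∷ []) ² ≤ (3 ^ c) ² * ((‖ f₁ ‖² * ‖ f₂ ‖²) * (‖ f₃ ‖² * ‖ f₄ ‖²))
  zeroWeight-bound zero    f₁ f₂ f₃ f₄ = ≤-reflexive (single-key (f₁ []) (f₂ []) (f₃ []) (f₄ []))
    where
    single-key : ∀ a b c d → (a * (b * (c * (d * 1))) * 1 + 0) * (a * (b * (c * (d * 1))) * 1 + 0)
                               ≡ 1 * 1 * ((a * a + 0) * (b * b + 0) * ((c * c + 0) * (d * d + 0)))
    single-key = solve-∀
  zeroWeight-bound (suc c) f₁ f₂ f₃ f₄ = begin
    zeroWeight fs ²                                  ≤⟨ *-mono-≤ W≤∑P W≤∑P ⟩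
    (∑[ π ∈ allFin 3 ] P π) ²                        ≤⟨ cauchy-schwarz (allFin 3) P (λ _ → K * N) (λ _ → 1) P²≤KN*1 ⟩
    (∑[ π ∈ allFin 3 ] K * N) * (∑[ π ∈ allFin 3 ] 1) ≡⟨ three-pairings (3 ^ c) N ⟩
    (3 ^ suc c) ² * N                                ∎
    where
    open ≤-Reasoning
    fs = f₁ ∷ f₂ ∷ f₃ ∷ f₄ ∷ []
    K = (3 ^ c) ²
    N = (‖ f₁ ‖² * ‖ f₂ ‖²) * (‖ f₃ ‖² * ‖ f₄ ‖²)
    P : Fin 3 → ℕ
    P π = ∑[ a ∈ allFin m ] ∑[ b ∈ allFin m ] zeroWeight (shift (pairing π a b) fs)
    W≤∑P : zeroWeight fs ≤ ∑[ π ∈ allFin 3 ] P π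
    W≤∑P = zeroWeight-≤-pairings fs
    P²≤KN*1 : ∀ π → P π ² ≤ K * N * 1
    P²≤KN*1 π = ≤-trans (pairing-sum-bound K (zeroWeight-bound c) π f₁ f₂ f₃ f₄)
                        (≤-reflexive (sym (*-identityʳ _)))
    three-pairings : ∀ t N → (t * t * N + (t * t * N + (t * t * N + 0))) * (1 + (1 + (1 + 0)))
                             ≡ (3 * t) * (3 * t) * N
    three-pairings = solve-∀

  module _ {c : ℕ} (S : List (Key m c)) where

    zeroCount≡zeroWeight : ∀ k → zeroCount S k ≡ zeroWeight (replicate k (multiplicity _≟ᵛ_ S))
    zeroCount≡zeroWeight k = trans
      (∑-via-multiplicity (≡-dec _≟ᵛ_) (enumerates-tuples _≟ᵛ_ (keys c) (enumerates-keys c) k) (tuples S k) _)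
      (∑-cong (tuples (keys c) k) λ xs → cong (_* 𝟙 (zeroSet? xs)) (multiplicity-tuples _≟ᵛ_ S xs))

    ‖multiplicity‖²≡length : Unique S → ‖ multiplicity _≟ᵛ_ S ‖² ≡ length S
    ‖multiplicity‖²≡length unique = begin
      ∑[ x ∈ keys c ] μ x ²       ≡⟨ ∑-cong (keys c) (λ x → n≤1⇒n²≡n*1 (unique⇒multiplicity≤1 _≟ᵛ_ unique x)) ⟩
      ∑[ x ∈ keys c ] μ x * 1     ≡⟨ ∑-via-multiplicity _≟ᵛ_ (enumerates-keys c) S (λ _ → 1) ⟨
      ∑[ x ∈ S ] 1                ≡⟨ length≡∑1 S ⟨
      length S                    ∎
      where
      open ≡-Reasoning
      μ = multiplicity _≟ᵛ_ S
      n≤1⇒n²≡n*1 : ∀ {n} → n ≤ 1 → n ² ≡ n * 1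
      n≤1⇒n²≡n*1 z≤n       = refl
      n≤1⇒n²≡n*1 (s≤s z≤n) = refl

    zeroCount-4-bound : Unique S → zeroCount S 4 ≤ 3 ^ c * length S ²
    zeroCount-4-bound unique = m²≤n²⇒m≤n _ _ (begin
      zeroCount S 4 ²                        ≡⟨ cong _² (zeroCount≡zeroWeight 4) ⟩
      zeroWeight (μ ∷ μ ∷ μ ∷ μ ∷ []) ²      ≤⟨ zeroWeight-bound c μ μ μ μ ⟩
      (3 ^ c) ² * ((‖ μ ‖² * ‖ μ ‖²) * (‖ μ ‖² * ‖ μ ‖²))
                                             ≡⟨ cong (λ n → (3 ^ c) ² * (n ² * n ²)) (‖multiplicity‖²≡length unique) ⟩
      (3 ^ c) ² * ((n * n) * (n * n))        ≡⟨ square-product (3 ^ c) n ⟩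
      (3 ^ c * n ²) ²                        ∎)
      where
      open ≤-Reasoning
      μ = multiplicity _≟ᵛ_ S
      n = length S
      square-product : ∀ t n → t * t * (n * n * (n * n)) ≡ t * (n * n) * (t * (n * n))
      square-product = solve-∀

corollary40 : (m c k : ℕ) (S : List (Key m c)) → Unique S → 4 ≤ k →
    length (filter zeroSet? (tuples S k)) ≤ 3 ^ c * length S ^ (k ∸ 2)
corollary40 m c (suc (suc (suc (suc r)))) S unique (s≤s (s≤s (s≤s (s≤s z≤n)))) = begin
  length (filter zeroSet? (tuples S (4 + r)))   ≡⟨ length-filter≡∑𝟙 zeroSet? (tuples S (4 + r)) ⟩
  zeroCount S (4 + r)                           ≤⟨ zeroCount-reduce-to-4 S r ⟩
  n ^ r * zeroCount S 4                         ≤⟨ *-monoʳ-≤ (n ^ r) (zeroCount-4-bound S unique) ⟩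
  n ^ r * (3 ^ c * n ²)                         ≡⟨ rearrange (n ^ r) (3 ^ c) n ⟩
  3 ^ c * n ^ (2 + r)                           ∎
  where
  open ≤-Reasoning
  n = length S
  rearrange : ∀ a b n → a * (b * (n * n)) ≡ b * (n * (n * a))
  rearrange = solve-∀
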